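{- Let $s\ge 2$ and let $f_1(x),\ldots,f_s(x)\in\mathbb{Z}[x]$ be nonzero coprime polynomials. For $n\in\mathbb{Z}$ let $d_n=\gcd(f_1(n),\ldots,f_s(n))$ and let $\mathcal{D}^\ast=\{d_n \mid n\in\mathbb{Z}\}$. Then the sequence $(d_n)_{n\in\mathbb{Z}}$ is periodic, the set $\mathcal{D}^\ast$ is finite, and $\mathcal{D}^\ast$ is stable under gcd and under lcm (i.e. for all $n_1,n_2\in\mathbb{Z}$ there exist $n,n'\in\mathbb{Z}$ with $\gcd(d_{n_1},d_{n_2})=d_n$ and $\operatorname{lcm}(d_{n_1},d_{n_2})=d_{n'}$). Consequently, the gcd $d^\ast$ and the lcm $m^\ast$ of all the integers $d_n$ ($n\in\mathbb{Z}$) belong to $\mathcal{D}^\ast$.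
   Context: Polynomials $f_1,\ldots,f_s\in\mathbb{Z}[x]$ are called coprime if their gcd in $\mathbb{Q}[x]$ is $1$, equivalently they have no common complex root. The gcd of integers is taken to be nonnegative. -}

module Defs where

open import Data.Nat as ℕ using (ℕ; zero; suc)
open import Data.Nat.GCD using (gcd)
open import Data.Integer as ℤ using (ℤ; +_; ∣_∣)
open import Data.Rational as ℚ using (ℚ)
open import Data.List using (List; []; _∷_; map)
open import Data.Fin using (Fin)
open import Data.Vec.Functional using (foldr)
open import Data.Product using (Σ; ∃; _×_)
open import Relation.Binary.PropositionalEquality using (_≡_)
open import Relation.Nullary using (¬_)

-- Polynomials are coefficient lists, constant term first.
-- Equality of polynomials is coefficientwise (trailing zeros irrelevant).
Polyℤ : Set
Polyℤ = List ℤ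

Polyℚ : Set
Polyℚ = List ℚ

coeffℤ : Polyℤ → ℕ → ℤ
coeffℤ []       _       = + 0
coeffℤ (a ∷ f)  zero    = a
coeffℤ (a ∷ f)  (suc k) = coeffℤ f k

coeffℚ : Polyℚ → ℕ → ℚ
coeffℚ []       _       = ℚ.0ℚ
coeffℚ (a ∷ f)  zero    = a
coeffℚ (a ∷ f)  (suc k) = coeffℚ f k

IsZeroPoly : Polyℤ → Set
IsZeroPoly f = ∀ k → coeffℤ f k ≡ + 0

eval : Polyℤ → ℤ → ℤ
eval []      x = + 0
eval (a ∷ f) x = a ℤ.+ x ℤ.* eval f x

_+ₚ_ : Polyℚ → Polyℚ → Polyℚ
[]      +ₚ g       = g
(a ∷ f) +ₚ []      = a ∷ f
(a ∷ f) +ₚ (b ∷ g) = (a ℚ.+ b) ∷ (f +ₚ g)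

_*ₚ_ : Polyℚ → Polyℚ → Polyℚ
[]      *ₚ g = []
(a ∷ f) *ₚ g = map (a ℚ.*_) g +ₚ (ℚ.0ℚ ∷ (f *ₚ g))

toℚ[x] : Polyℤ → Polyℚ
toℚ[x] = map (λ z → z ℚ./ 1)

_∣ₚ_ : Polyℚ → Polyℚ → Set
g ∣ₚ f = Σ Polyℚ λ h → ∀ k → coeffℚ (g *ₚ h) k ≡ coeffℚ f k

IsConstant : Polyℚ → Set
IsConstant g = ∀ k → coeffℚ g (suc k) ≡ ℚ.0ℚ

-- f₁,…,fₛ coprime: their gcd in ℚ[x] is 1, i.e. every common divisor
-- in ℚ[x] is a unit (a constant; it is nonzero automatically since the fᵢ are nonzero).
Coprime : ∀ {s} → (Fin s → Polyℤ) → Set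
Coprime {s} f = ∀ (g : Polyℚ) → (∀ i → g ∣ₚ toℚ[x] (f i)) → IsConstant g

-- gcd of a finite family of naturals (gcd of empty family = 0)
gcdFam : ∀ {s} → (Fin s → ℕ) → ℕ
gcdFam = foldr gcd 0

dₙ : ∀ {s} → (Fin s → Polyℤ) → ℤ → ℕ
dₙ f n = gcdFam (λ i → ∣ eval (f i) n ∣)

module Submission where

-- Step 1 (GcdOfValues, using IntegerPolynomials, PolynomialDivision and
-- RationalLift): some N ≠ 0 is divisible by every d(n).  Call p ∈ ℤ[x]
-- admissible if d(n) ∣ p(n) for all n.  The fᵢ are admissible, and so are
-- pseudo-remainders M·a - p·q of admissible polynomials.  Euclid's algorithm
-- on admissible polynomials lowers the degree until the current p divides
-- every fᵢ in ℚ[x]; coprimality then makes p a nonzero constant c, N = |c|.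
-- Step 1 also shows that gcd(d(x), M) depends only on x mod M.
--
-- Taking M = N shows d is N-periodic; a divisor of N = U·V (U, V coprime) is fixed by its U- and
-- V-parts, which the Chinese remainder theorem lets us prescribe separately,
-- so g = gcd(d(n₁), d(n₂)) and lcm(d(n₁), d(n₂)) are values; folding gcd and
-- lcm over one period gives d* and m*.

open import Defs
open import Data.Nat as ℕ using (ℕ)
import Data.Nat.Divisibility as ℕ
import Data.Nat.GCD as ℕ
open import Data.Integer as ℤ using (ℤ; +_)
import Data.Integer.Divisibility.Signed as ℤ
open import Data.Fin using (Fin)
open import Relation.Binary.PropositionalEquality using (_≡_; _≢_)

module IntegerPolynomials where

  open import Data.Nat using (zero; suc)
  open import Data.Integer using (ℤ; +_; _+_; _*_; _-_)
  import Data.Integer.Properties as ℤ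
  open import Data.Integer.Divisibility.Signed using (_∣_; divides; ∣m∣n⇒∣m+n; ∣n⇒∣m*n; ∣m⇒∣m*n)
  open import Data.Integer.Tactic.RingSolver using (solve-∀)
  open import Data.List using ([]; _∷_; map)
  open import Relation.Binary.PropositionalEquality

  infixl 6 _⊕_
  infixr 7 _·_
  infixl 7 _⊛_

  -- Sum, scalar multiple and product in ℤ[x]; the product follows the
  -- recursion of _*ₚ_ on ℚ[x], so that the two can be compared termwise.
  _⊕_ : Polyℤ → Polyℤ → Polyℤ
  []      ⊕ g       = g
  (a ∷ f) ⊕ []      = a ∷ f
  (a ∷ f) ⊕ (b ∷ g) = (a + b) ∷ (f ⊕ g)

  _·_ : ℤ → Polyℤ → Polyℤ
  c · g = map (c *_) g

  _⊛_ : Polyℤ → Polyℤ → Polyℤ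
  []      ⊛ q = []
  (b ∷ p) ⊛ q = b · q ⊕ (+ 0 ∷ p ⊛ q)

  coeff-⊕ : ∀ f g k → coeffℤ (f ⊕ g) k ≡ coeffℤ f k + coeffℤ g k
  coeff-⊕ []      g       k       = sym (ℤ.+-identityˡ _)
  coeff-⊕ (a ∷ f) []      k       = sym (ℤ.+-identityʳ _)
  coeff-⊕ (a ∷ f) (b ∷ g) zero    = refl
  coeff-⊕ (a ∷ f) (b ∷ g) (suc k) = coeff-⊕ f g k

  coeff-· : ∀ c g k → coeffℤ (c · g) k ≡ c * coeffℤ g k
  coeff-· c []      k       = sym (ℤ.*-zeroʳ c)
  coeff-· c (a ∷ g) zero    = refl
  coeff-· c (a ∷ g) (suc k) = coeff-· c g k

  coeff-∷⊛ : ∀ b p q k → coeffℤ ((b ∷ p) ⊛ q) k ≡ b * coeffℤ q k + coeffℤ (+ 0 ∷ p ⊛ q) k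
  coeff-∷⊛ b p q k = trans (coeff-⊕ (b · q) (+ 0 ∷ p ⊛ q) k) (cong (_+ _) (coeff-· b q k))

  coeff-⊛[] : ∀ p k → coeffℤ (p ⊛ []) k ≡ + 0
  coeff-⊛[] []      k       = refl
  coeff-⊛[] (b ∷ p) zero    = refl
  coeff-⊛[] (b ∷ p) (suc k) = coeff-⊛[] p k

  coeff-⊛· : ∀ p c w k → coeffℤ (p ⊛ (c · w)) k ≡ c * coeffℤ (p ⊛ w) k
  coeff-⊛· []      c w k = sym (ℤ.*-zeroʳ c)
  coeff-⊛· (b ∷ p) c w k = begin
      coeffℤ ((b ∷ p) ⊛ (c · w)) k
    ≡⟨ coeff-∷⊛ b p (c · w) k ⟩
      b * coeffℤ (c · w) k + coeffℤ (+ 0 ∷ p ⊛ (c · w)) k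
    ≡⟨ cong₂ (λ u v → b * u + v) (coeff-· c w k) (shifted k) ⟩
      b * (c * coeffℤ w k) + c * coeffℤ (+ 0 ∷ p ⊛ w) k
    ≡⟨ lemma b c _ _ ⟩
      c * (b * coeffℤ w k + coeffℤ (+ 0 ∷ p ⊛ w) k)
    ≡⟨ cong (c *_) (sym (coeff-∷⊛ b p w k)) ⟩
      c * coeffℤ ((b ∷ p) ⊛ w) k ∎
    where
    open ≡-Reasoning
    lemma : ∀ b c u v → b * (c * u) + c * v ≡ c * (b * u + v)
    lemma = solve-∀
    shifted : ∀ k → coeffℤ (+ 0 ∷ p ⊛ (c · w)) k ≡ c * coeffℤ (+ 0 ∷ p ⊛ w) k
    shifted zero    = sym (ℤ.*-zeroʳ c)
    shifted (suc k) = coeff-⊛· p c w k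

  coeff-⊛∷ : ∀ p t w k → coeffℤ (p ⊛ (t ∷ w)) k ≡ t * coeffℤ p k + coeffℤ (+ 0 ∷ p ⊛ w) k
  coeff-⊛∷ []      t w zero    = sym (trans (ℤ.+-identityʳ _) (ℤ.*-zeroʳ t))
  coeff-⊛∷ []      t w (suc k) = sym (trans (ℤ.+-identityʳ _) (ℤ.*-zeroʳ t))
  coeff-⊛∷ (b ∷ p) t w zero    = cong (_+ + 0) (ℤ.*-comm b t)
  coeff-⊛∷ (b ∷ p) t w (suc k) = begin
      coeffℤ ((b ∷ p) ⊛ (t ∷ w)) (suc k)
    ≡⟨ coeff-∷⊛ b p (t ∷ w) (suc k) ⟩
      b * coeffℤ w k + coeffℤ (p ⊛ (t ∷ w)) k
    ≡⟨ cong (λ v → b * coeffℤ w k + v) (coeff-⊛∷ p t w k) ⟩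
      b * coeffℤ w k + (t * coeffℤ p k + coeffℤ (+ 0 ∷ p ⊛ w) k)
    ≡⟨ lemma (b * coeffℤ w k) (t * coeffℤ p k) _ ⟩
      t * coeffℤ p k + (b * coeffℤ w k + coeffℤ (+ 0 ∷ p ⊛ w) k)
    ≡⟨ cong (λ v → t * coeffℤ p k + v) (sym (coeff-∷⊛ b p w k)) ⟩
      t * coeffℤ p k + coeffℤ ((b ∷ p) ⊛ w) k ∎
    where
    open ≡-Reasoning
    lemma : ∀ u v r → u + (v + r) ≡ v + (u + r)
    lemma = solve-∀

  eval-⊕ : ∀ f g x → eval (f ⊕ g) x ≡ eval f x + eval g x
  eval-⊕ []      g       x = sym (ℤ.+-identityˡ _)
  eval-⊕ (a ∷ f) []      x = sym (ℤ.+-identityʳ _)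
  eval-⊕ (a ∷ f) (b ∷ g) x = begin
      (a + b) + x * eval (f ⊕ g) x
    ≡⟨ cong (λ v → (a + b) + x * v) (eval-⊕ f g x) ⟩
      (a + b) + x * (eval f x + eval g x)
    ≡⟨ lemma a b x _ _ ⟩
      (a + x * eval f x) + (b + x * eval g x) ∎
    where
    open ≡-Reasoning
    lemma : ∀ a b x u v → (a + b) + x * (u + v) ≡ (a + x * u) + (b + x * v)
    lemma = solve-∀

  eval-· : ∀ c g x → eval (c · g) x ≡ c * eval g x
  eval-· c []      x = sym (ℤ.*-zeroʳ c)
  eval-· c (a ∷ g) x = begin
      c * a + x * eval (c · g) x
    ≡⟨ cong (λ v → c * a + x * v) (eval-· c g x) ⟩
      c * a + x * (c * eval g x)
    ≡⟨ lemma c a x _ ⟩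
      c * (a + x * eval g x) ∎
    where
    open ≡-Reasoning
    lemma : ∀ c a x u → c * a + x * (c * u) ≡ c * (a + x * u)
    lemma = solve-∀

  eval-⊛ : ∀ p q x → eval (p ⊛ q) x ≡ eval p x * eval q x
  eval-⊛ []      q x = refl
  eval-⊛ (b ∷ p) q x = begin
      eval (b · q ⊕ (+ 0 ∷ p ⊛ q)) x
    ≡⟨ eval-⊕ (b · q) (+ 0 ∷ p ⊛ q) x ⟩
      eval (b · q) x + (+ 0 + x * eval (p ⊛ q) x)
    ≡⟨ cong₂ (λ u v → u + (+ 0 + x * v)) (eval-· b q x) (eval-⊛ p q x) ⟩
      b * eval q x + (+ 0 + x * (eval p x * eval q x))
    ≡⟨ lemma b (eval q x) x (eval p x) ⟩
      (b + x * eval p x) * eval q x ∎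
    where
    open ≡-Reasoning
    lemma : ∀ b v x u → b * v + (+ 0 + x * (u * v)) ≡ (b + x * u) * v
    lemma = solve-∀

  eval-zero : ∀ u x → IsZeroPoly u → eval u x ≡ + 0
  eval-zero []      x u≈0 = refl
  eval-zero (a ∷ u) x u≈0 = begin
      a + x * eval u x
    ≡⟨ cong₂ (λ a v → a + x * v) (u≈0 0) (eval-zero u x (λ k → u≈0 (suc k))) ⟩
      + 0 + x * + 0
    ≡⟨ trans (ℤ.+-identityˡ _) (ℤ.*-zeroʳ x) ⟩
      + 0 ∎
    where open ≡-Reasoning

  eval-coeffwise : ∀ u v x → (∀ k → coeffℤ u k ≡ coeffℤ v k) → eval u x ≡ eval v x
  eval-coeffwise []      v       x u≈v = sym (eval-zero v x (λ k → sym (u≈v k)))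
  eval-coeffwise (a ∷ u) []      x u≈v = eval-zero (a ∷ u) x u≈v
  eval-coeffwise (a ∷ u) (b ∷ v) x u≈v =
    cong₂ (λ c w → c + x * w) (u≈v 0) (eval-coeffwise u v x (λ k → u≈v (suc k)))

  eval-identity : ∀ M a p q r → (∀ k → M * coeffℤ a k ≡ coeffℤ (p ⊛ q) k + coeffℤ r k) →
                  ∀ x → M * eval a x ≡ eval p x * eval q x + eval r x
  eval-identity M a p q r identity x = begin
      M * eval a x
    ≡⟨ sym (eval-· M a x) ⟩
      eval (M · a) x
    ≡⟨ eval-coeffwise (M · a) (p ⊛ q ⊕ r) x coeffs ⟩
      eval (p ⊛ q ⊕ r) x
    ≡⟨ eval-⊕ (p ⊛ q) r x ⟩
      eval (p ⊛ q) x + eval r x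
    ≡⟨ cong (_+ eval r x) (eval-⊛ p q x) ⟩
      eval p x * eval q x + eval r x ∎
    where
    open ≡-Reasoning
    coeffs : ∀ k → coeffℤ (M · a) k ≡ coeffℤ (p ⊛ q ⊕ r) k
    coeffs k = trans (coeff-· M a k) (trans (identity k) (sym (coeff-⊕ (p ⊛ q) r k)))

  eval-congruence : ∀ (M x y : ℤ) → M ∣ x - y → ∀ p → M ∣ eval p x - eval p y
  eval-congruence M x y M∣x-y []      = divides (+ 0) (sym (ℤ.*-zeroˡ M))
  eval-congruence M x y M∣x-y (a ∷ p) = subst (M ∣_) (sym (lemma a x y (eval p x) (eval p y)))
    (∣m∣n⇒∣m+n (∣n⇒∣m*n x (eval-congruence M x y M∣x-y p)) (∣m⇒∣m*n (eval p y) M∣x-y))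
    where
    lemma : ∀ a x y u v → (a + x * u) - (a + y * v) ≡ x * (u - v) + (x - y) * v
    lemma = solve-∀

module PolynomialDivision where

  open IntegerPolynomials
  open import Data.Nat using (ℕ; zero; suc; z≤n; s≤s; _<_; _≤_)
  import Data.Nat.Properties as ℕ
  open import Data.Integer using (ℤ; +_; _+_; _*_; -_)
  import Data.Integer.Properties as ℤ
  open import Data.Integer.Tactic.RingSolver using (solve-∀)
  open import Data.List using ([]; _∷_; length)
  open import Data.Product using (∃; _×_; _,_)
  open import Data.Sum using (_⊎_; inj₁; inj₂; [_,_]′)
  open import Relation.Nullary using (yes; no)
  open import Relation.Binary.PropositionalEquality

  DegreeBelow : Polyℤ → ℕ → Set
  DegreeBelow r m = ∀ k → m ≤ k → coeffℤ r k ≡ + 0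

  ExactDegree : Polyℤ → ℕ → Set
  ExactDegree p m = coeffℤ p m ≢ + 0 × DegreeBelow p (suc m)

  degreeBelow-length : ∀ p → DegreeBelow p (length p)
  degreeBelow-length []      k       _         = refl
  degreeBelow-length (a ∷ p) (suc k) (s≤s l≤k) = degreeBelow-length p k l≤k

  degreeBelow-pred : ∀ {r B} → DegreeBelow r (suc B) → coeffℤ r B ≡ + 0 → DegreeBelow r B
  degreeBelow-pred r<1+B rB≡0 k B≤k with ℕ.m≤n⇒m<n∨m≡n B≤k
  ... | inj₁ B<k  = r<1+B k B<k
  ... | inj₂ refl = rB≡0

  zero-or-degree : ∀ B r → DegreeBelow r B → IsZeroPoly r ⊎ ∃ λ m → m < B × ExactDegree r m
  zero-or-degree zero    r r<0 = inj₁ (λ k → r<0 k z≤n)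
  zero-or-degree (suc B) r r<1+B with coeffℤ r B ℤ.≟ + 0
  ... | no  rB≢0 = inj₂ (B , ℕ.n<1+n B , rB≢0 , r<1+B)
  ... | yes rB≡0 with zero-or-degree B r (degreeBelow-pred {r} r<1+B rB≡0)
  ...   | inj₁ r≡0               = inj₁ r≡0
  ...   | inj₂ (m , m<B , deg-m) = inj₂ (m , ℕ.m<n⇒m<1+n m<B , deg-m)

  -- Pseudo-division by p of exact degree m, without leaving ℤ[x]:
  -- M·a = p·q + r with M ≠ 0 and deg r < m.
  record PseudoDivision (p : Polyℤ) (m : ℕ) (a : Polyℤ) : Set where
    field
      multiplier       : ℤ
      multiplier≢0     : multiplier ≢ + 0
      quotient         : Polyℤ
      remainder        : Polyℤ
      identity         : ∀ k → multiplier * coeffℤ a k ≡ coeffℤ (p ⊛ quotient) k + coeffℤ remainder k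
      remainder-degree : DegreeBelow remainder m

  -- Induction on a = a₀ + x·a': from M·a' = p·q' + r', the polynomial
  -- w = M·a₀ + x·r' has degree ≤ m, and cancelling its x^m-coefficient t
  -- against the leading coefficient c of p gives
  -- (c·M)·a = p·(t + x·c·q') + (c·w - t·p).
  pseudoDivide : ∀ {p m} → ExactDegree p m → ∀ a → PseudoDivision p m a
  pseudoDivide {p} {m} deg-p [] = record
    { multiplier       = + 1
    ; multiplier≢0     = λ ()
    ; quotient         = []
    ; remainder        = []
    ; identity         = λ k → sym (trans (ℤ.+-identityʳ _) (coeff-⊛[] p k))
    ; remainder-degree = λ _ _ → refl
    }
  pseudoDivide {p} {m} deg-p@(c≢0 , p<1+m) (a₀ ∷ a') = record
    { multiplier       = c * M
    ; multiplier≢0     = λ cM≡0 → [ c≢0 , M≢0 ]′ (ℤ.i*j≡0⇒i≡0∨j≡0 c cM≡0)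
    ; quotient         = t ∷ c · q'
    ; remainder        = c · w ⊕ (- t) · p
    ; identity         = identity
    ; remainder-degree = remainder-degree
    }
    where
    open PseudoDivision (pseudoDivide {p} {m} deg-p a')
      renaming (multiplier to M; multiplier≢0 to M≢0; quotient to q'; remainder to r';
                identity to identity'; remainder-degree to r'<m)
    c : ℤ
    c = coeffℤ p m
    w : Polyℤ
    w = M * a₀ ∷ r'
    t : ℤ
    t = coeffℤ w m

    shifted-identity : ∀ k → M * coeffℤ (a₀ ∷ a') k ≡ coeffℤ (+ 0 ∷ p ⊛ q') k + coeffℤ w k
    shifted-identity zero    = sym (ℤ.+-identityˡ _)
    shifted-identity (suc k) = identity' k

    shifted-scaling : ∀ k → coeffℤ (+ 0 ∷ p ⊛ (c · q')) k ≡ c * coeffℤ (+ 0 ∷ p ⊛ q') k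
    shifted-scaling zero    = sym (ℤ.*-zeroʳ c)
    shifted-scaling (suc k) = coeff-⊛· p c q' k

    coeff-remainder : ∀ k → coeffℤ (c · w ⊕ (- t) · p) k ≡ c * coeffℤ w k + (- t) * coeffℤ p k
    coeff-remainder k = trans (coeff-⊕ (c · w) ((- t) · p) k) (cong₂ _+_ (coeff-· c w k) (coeff-· (- t) p k))

    identity : ∀ k → (c * M) * coeffℤ (a₀ ∷ a') k ≡
               coeffℤ (p ⊛ (t ∷ c · q')) k + coeffℤ (c · w ⊕ (- t) · p) k
    identity k = begin
        (c * M) * coeffℤ (a₀ ∷ a') k
      ≡⟨ ℤ.*-assoc c M _ ⟩
        c * (M * coeffℤ (a₀ ∷ a') k)
      ≡⟨ cong (c *_) (shifted-identity k) ⟩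
        c * (coeffℤ (+ 0 ∷ p ⊛ q') k + coeffℤ w k)
      ≡⟨ rearrange c t _ _ (coeffℤ p k) ⟩
        (t * coeffℤ p k + c * coeffℤ (+ 0 ∷ p ⊛ q') k) + (c * coeffℤ w k + (- t) * coeffℤ p k)
      ≡⟨ sym (cong₂ _+_ (trans (coeff-⊛∷ p t (c · q') k) (cong (λ v → t * coeffℤ p k + v) (shifted-scaling k)))
                        (coeff-remainder k)) ⟩
        coeffℤ (p ⊛ (t ∷ c · q')) k + coeffℤ (c · w ⊕ (- t) · p) k ∎
      where
      open ≡-Reasoning
      rearrange : ∀ c t s v u → c * (s + v) ≡ (t * u + c * s) + (c * v + (- t) * u)
      rearrange = solve-∀

    w<1+m : DegreeBelow w (suc m)
    w<1+m (suc k) (s≤s m≤k) = r'<m k m≤k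

    remainder-degree : DegreeBelow (c · w ⊕ (- t) · p) m
    remainder-degree k m≤k with ℕ.m≤n⇒m<n∨m≡n m≤k
    ... | inj₂ refl = trans (coeff-remainder m) (cancel c t)
      where
      cancel : ∀ c t → c * t + (- t) * c ≡ + 0
      cancel = solve-∀
    ... | inj₁ m<k  = trans (coeff-remainder k) (begin
        c * coeffℤ w k + (- t) * coeffℤ p k
      ≡⟨ cong₂ (λ u v → c * u + (- t) * v) (w<1+m k m<k) (p<1+m k m<k) ⟩
        c * + 0 + (- t) * + 0
      ≡⟨ cong₂ _+_ (ℤ.*-zeroʳ c) (ℤ.*-zeroʳ (- t)) ⟩
        + 0 ∎)
      where open ≡-Reasoning

module RationalLift where

  open IntegerPolynomials
  open PolynomialDivision using (DegreeBelow)
  open import Data.Nat using (zero; suc; s≤s)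
  open import Data.Integer as ℤ using (ℤ; +_; ∣_∣)
  import Data.Integer.Properties as ℤ
  open import Data.Rational as ℚ using (ℚ; mkℚ; 0ℚ; 1ℚ; _/_; ↥_; 1/_)
  import Data.Rational.Properties as ℚ
  open import Data.Nat.Coprimality using (1-coprimeTo) renaming (sym to coprime-sym)
  open import Data.List using ([]; _∷_; map)
  open import Data.Product using (_,_)
  open import Relation.Binary.PropositionalEquality

  ι : ℤ → ℚ
  ι z = z / 1

  ι-normal : ∀ a → ι a ≡ mkℚ a 0 (coprime-sym (1-coprimeTo ∣ a ∣))
  ι-normal a = ℚ.↥p/↧p≡p (mkℚ a 0 (coprime-sym (1-coprimeTo ∣ a ∣)))

  ι-* : ∀ a b → ι (a ℤ.* b) ≡ ι a ℚ.* ι b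
  ι-* a b rewrite ι-normal a | ι-normal b = refl

  ι-+ : ∀ a b → ι (a ℤ.+ b) ≡ ι a ℚ.+ ι b
  ι-+ a b rewrite ι-normal a | ι-normal b =
    cong (_/ 1) (cong₂ ℤ._+_ (sym (ℤ.*-identityʳ a)) (sym (ℤ.*-identityʳ b)))

  ι≡0 : ∀ a → ι a ≡ 0ℚ → a ≡ + 0
  ι≡0 a ιa≡0 = trans (sym (cong ↥_ (ι-normal a))) (ℚ.p≡0⇒↥p≡0 (ι a) ιa≡0)

  coeff-toℚ : ∀ a k → coeffℚ (toℚ[x] a) k ≡ ι (coeffℤ a k)
  coeff-toℚ []      k       = refl
  coeff-toℚ (a ∷ f) zero    = refl
  coeff-toℚ (a ∷ f) (suc k) = coeff-toℚ f k

  coeff-+ₚ : ∀ f g k → coeffℚ (f +ₚ g) k ≡ coeffℚ f k ℚ.+ coeffℚ g k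
  coeff-+ₚ []      g       k       = sym (ℚ.+-identityˡ _)
  coeff-+ₚ (a ∷ f) []      k       = sym (ℚ.+-identityʳ _)
  coeff-+ₚ (a ∷ f) (b ∷ g) zero    = refl
  coeff-+ₚ (a ∷ f) (b ∷ g) (suc k) = coeff-+ₚ f g k

  coeff-scaleₚ : ∀ c g k → coeffℚ (map (c ℚ.*_) g) k ≡ c ℚ.* coeffℚ g k
  coeff-scaleₚ c []      k       = sym (ℚ.*-zeroʳ c)
  coeff-scaleₚ c (a ∷ g) zero    = refl
  coeff-scaleₚ c (a ∷ g) (suc k) = coeff-scaleₚ c g k

  coeff-toℚ-⊛ : ∀ p q k → coeffℚ (toℚ[x] p *ₚ toℚ[x] q) k ≡ ι (coeffℤ (p ⊛ q) k)
  coeff-toℚ-⊛ []      q k = refl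
  coeff-toℚ-⊛ (b ∷ p) q k = begin
      coeffℚ (map (ι b ℚ.*_) (toℚ[x] q) +ₚ (0ℚ ∷ (toℚ[x] p *ₚ toℚ[x] q))) k
    ≡⟨ coeff-+ₚ (map (ι b ℚ.*_) (toℚ[x] q)) (0ℚ ∷ (toℚ[x] p *ₚ toℚ[x] q)) k ⟩
      coeffℚ (map (ι b ℚ.*_) (toℚ[x] q)) k ℚ.+ coeffℚ (0ℚ ∷ (toℚ[x] p *ₚ toℚ[x] q)) k
    ≡⟨ cong₂ ℚ._+_ head (shifted k) ⟩
      ι (b ℤ.* coeffℤ q k) ℚ.+ ι (coeffℤ (+ 0 ∷ p ⊛ q) k)
    ≡⟨ sym (ι-+ (b ℤ.* coeffℤ q k) (coeffℤ (+ 0 ∷ p ⊛ q) k)) ⟩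
      ι (b ℤ.* coeffℤ q k ℤ.+ coeffℤ (+ 0 ∷ p ⊛ q) k)
    ≡⟨ cong ι (sym (coeff-∷⊛ b p q k)) ⟩
      ι (coeffℤ ((b ∷ p) ⊛ q) k) ∎
    where
    open ≡-Reasoning
    head : coeffℚ (map (ι b ℚ.*_) (toℚ[x] q)) k ≡ ι (b ℤ.* coeffℤ q k)
    head = trans (coeff-scaleₚ (ι b) (toℚ[x] q) k)
                 (trans (cong (ι b ℚ.*_) (coeff-toℚ q k)) (sym (ι-* b (coeffℤ q k))))
    shifted : ∀ k → coeffℚ (0ℚ ∷ (toℚ[x] p *ₚ toℚ[x] q)) k ≡ ι (coeffℤ (+ 0 ∷ p ⊛ q) k)
    shifted zero    = refl
    shifted (suc k) = coeff-toℚ-⊛ p q k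

  coeff-*ₚ-scale : ∀ g α h k → coeffℚ (g *ₚ map (α ℚ.*_) h) k ≡ α ℚ.* coeffℚ (g *ₚ h) k
  coeff-*ₚ-scale []      α h k = sym (ℚ.*-zeroʳ α)
  coeff-*ₚ-scale (b ∷ g) α h k = begin
      coeffℚ (map (b ℚ.*_) (map (α ℚ.*_) h) +ₚ (0ℚ ∷ (g *ₚ map (α ℚ.*_) h))) k
    ≡⟨ coeff-+ₚ (map (b ℚ.*_) (map (α ℚ.*_) h)) (0ℚ ∷ (g *ₚ map (α ℚ.*_) h)) k ⟩
      coeffℚ (map (b ℚ.*_) (map (α ℚ.*_) h)) k ℚ.+ coeffℚ (0ℚ ∷ (g *ₚ map (α ℚ.*_) h)) k
    ≡⟨ cong₂ ℚ._+_ head (shifted k) ⟩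
      α ℚ.* (b ℚ.* coeffℚ h k) ℚ.+ α ℚ.* coeffℚ (0ℚ ∷ (g *ₚ h)) k
    ≡⟨ sym (ℚ.*-distribˡ-+ α _ _) ⟩
      α ℚ.* (b ℚ.* coeffℚ h k ℚ.+ coeffℚ (0ℚ ∷ (g *ₚ h)) k)
    ≡⟨ cong (α ℚ.*_) (sym (trans (coeff-+ₚ (map (b ℚ.*_) h) (0ℚ ∷ (g *ₚ h)) k)
                                 (cong (ℚ._+ coeffℚ (0ℚ ∷ (g *ₚ h)) k) (coeff-scaleₚ b h k)))) ⟩
      α ℚ.* coeffℚ ((b ∷ g) *ₚ h) k ∎
    where
    open ≡-Reasoning
    head : coeffℚ (map (b ℚ.*_) (map (α ℚ.*_) h)) k ≡ α ℚ.* (b ℚ.* coeffℚ h k)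
    head = begin
        coeffℚ (map (b ℚ.*_) (map (α ℚ.*_) h)) k
      ≡⟨ trans (coeff-scaleₚ b (map (α ℚ.*_) h) k) (cong (b ℚ.*_) (coeff-scaleₚ α h k)) ⟩
        b ℚ.* (α ℚ.* coeffℚ h k)
      ≡⟨ sym (ℚ.*-assoc b α _) ⟩
        (b ℚ.* α) ℚ.* coeffℚ h k
      ≡⟨ cong (ℚ._* coeffℚ h k) (ℚ.*-comm b α) ⟩
        (α ℚ.* b) ℚ.* coeffℚ h k
      ≡⟨ ℚ.*-assoc α b _ ⟩
        α ℚ.* (b ℚ.* coeffℚ h k) ∎
    shifted : ∀ k → coeffℚ (0ℚ ∷ (g *ₚ map (α ℚ.*_) h)) k ≡ α ℚ.* coeffℚ (0ℚ ∷ (g *ₚ h)) k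
    shifted zero    = sym (ℚ.*-zeroʳ α)
    shifted (suc k) = coeff-*ₚ-scale g α h k

  divides-in-ℚ[x] : ∀ p a M q → M ≢ + 0 → (∀ k → M ℤ.* coeffℤ a k ≡ coeffℤ (p ⊛ q) k) →
                    toℚ[x] p ∣ₚ toℚ[x] a
  divides-in-ℚ[x] p a M q M≢0 M·a≡p·q = map (1/ ι M ℚ.*_) (toℚ[x] q) , coeffs
    where
    instance
      ιM≢0 : ℚ.NonZero (ι M)
      ιM≢0 = ℚ.≢-nonZero (λ ιM≡0 → M≢0 (ι≡0 M ιM≡0))
    coeffs : ∀ k → coeffℚ (toℚ[x] p *ₚ map (1/ ι M ℚ.*_) (toℚ[x] q)) k ≡ coeffℚ (toℚ[x] a) k
    coeffs k = begin
        coeffℚ (toℚ[x] p *ₚ map (1/ ι M ℚ.*_) (toℚ[x] q)) k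
      ≡⟨ coeff-*ₚ-scale (toℚ[x] p) (1/ ι M) (toℚ[x] q) k ⟩
        1/ ι M ℚ.* coeffℚ (toℚ[x] p *ₚ toℚ[x] q) k
      ≡⟨ cong (1/ ι M ℚ.*_) (trans (coeff-toℚ-⊛ p q k) (cong ι (sym (M·a≡p·q k)))) ⟩
        1/ ι M ℚ.* ι (M ℤ.* coeffℤ a k)
      ≡⟨ cong (1/ ι M ℚ.*_) (ι-* M (coeffℤ a k)) ⟩
        1/ ι M ℚ.* (ι M ℚ.* ι (coeffℤ a k))
      ≡⟨ sym (ℚ.*-assoc (1/ ι M) (ι M) _) ⟩
        (1/ ι M ℚ.* ι M) ℚ.* ι (coeffℤ a k)
      ≡⟨ cong (ℚ._* ι (coeffℤ a k)) (ℚ.*-inverseˡ (ι M)) ⟩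
        1ℚ ℚ.* ι (coeffℤ a k)
      ≡⟨ ℚ.*-identityˡ _ ⟩
        ι (coeffℤ a k)
      ≡⟨ sym (coeff-toℚ a k) ⟩
        coeffℚ (toℚ[x] a) k ∎
      where open ≡-Reasoning

  constant-in-ℤ[x] : ∀ p → IsConstant (toℚ[x] p) → DegreeBelow p 1
  constant-in-ℤ[x] p p-const (suc k) (s≤s _) = ι≡0 _ (trans (sym (coeff-toℚ p (suc k))) (p-const k))

module FiniteFamilies where

  open import Data.Nat using (ℕ; zero; suc)
  open import Data.Nat.Divisibility using (_∣_; ∣-trans; _∣0)
  open import Data.Nat.GCD using (gcd[m,n]∣m; gcd[m,n]∣n; gcd-greatest)
  open import Data.Fin using (Fin; zero; suc)
  open import Data.Fin.Properties using (∀-cons)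
  open import Data.Product using (∃; _,_)
  open import Data.Sum using (_⊎_; inj₁; inj₂)
  open import Function using (_∘_)

  gcdFam-∣ : ∀ {s} (g : Fin s → ℕ) i → gcdFam g ∣ g i
  gcdFam-∣ g zero    = gcd[m,n]∣m (g zero) (gcdFam (g ∘ suc))
  gcdFam-∣ g (suc i) = ∣-trans (gcd[m,n]∣n (g zero) (gcdFam (g ∘ suc))) (gcdFam-∣ (g ∘ suc) i)

  gcdFam-greatest : ∀ {s} (g : Fin s → ℕ) {c} → (∀ i → c ∣ g i) → c ∣ gcdFam g
  gcdFam-greatest {zero}  g {c} c∣g = c ∣0
  gcdFam-greatest {suc s} g c∣g = gcd-greatest (c∣g zero) (gcdFam-greatest (g ∘ suc) (c∣g ∘ suc))

  all-or-some : ∀ {s a b} {A : Fin s → Set a} {B : Fin s → Set b} →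
                (∀ i → A i ⊎ B i) → (∀ i → A i) ⊎ ∃ B
  all-or-some {zero}  A⊎B = inj₁ (λ ())
  all-or-some {suc s} A⊎B with A⊎B zero | all-or-some (A⊎B ∘ suc)
  ... | inj₂ b₀ | _             = inj₂ (zero , b₀)
  ... | inj₁ a₀ | inj₂ (i , bᵢ) = inj₂ (suc i , bᵢ)
  ... | inj₁ a₀ | inj₁ all-a    = inj₁ (∀-cons a₀ all-a)

module GcdOfValues {s : ℕ} (f : Fin s → Polyℤ) where

  open IntegerPolynomials
  open PolynomialDivision
  open RationalLift
  open FiniteFamilies
  open import Data.Nat using (zero; suc; _<_; z≤n; s≤s)
  open import Data.Nat.Divisibility using (∣-antisym) renaming (_∣_ to _ℕ∣_)
  open import Data.Nat.GCD using (gcd; gcd-greatest; gcd[m,n]∣m; gcd[m,n]∣n)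
  open import Data.Nat.Induction using (<-rec)
  open import Data.Integer using (ℤ; +_; -_; ∣_∣; _+_; _-_)
  import Data.Integer.Properties as ℤ
  open import Data.Integer.Divisibility.Signed
    using (_∣_; ∣ᵤ⇒∣; ∣⇒∣ᵤ; ∣-trans; ∣m⇒∣-m; ∣m∣n⇒∣m-n; ∣n⇒∣m*n; ∣m⇒∣m*n; ∣m+n∣m⇒∣n)
  open import Data.Integer.Tactic.RingSolver using (solve-∀)
  open import Data.List using ([]; _∷_; length)
  open import Data.Product using (Σ; ∃; _×_; _,_)
  open import Data.Sum using (_⊎_; inj₁; inj₂)
  open import Data.Empty using (⊥-elim)
  open import Relation.Nullary using (¬_)
  open import Relation.Binary.PropositionalEquality

  d : ℤ → ℕ
  d = dₙ f

  Admissible : Polyℤ → Set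
  Admissible p = ∀ n → + d n ∣ eval p n

  admissible-f : ∀ i → Admissible (f i)
  admissible-f i n = ∣ᵤ⇒∣ (gcdFam-∣ (λ j → ∣ eval (f j) n ∣) i)

  admissible-remainder : ∀ {p m a} (D : PseudoDivision p m a) → Admissible a → Admissible p →
                         Admissible (PseudoDivision.remainder D)
  admissible-remainder {p} {a = a} D adm-a adm-p n =
    ∣m+n∣m⇒∣n (subst (+ d n ∣_) (eval-identity M a p q r identity n) (∣n⇒∣m*n M (adm-a n)))
              (∣m⇒∣m*n (eval q n) (adm-p n))
    where
    open PseudoDivision D renaming (multiplier to M; quotient to q; remainder to r)

  Bound : Set
  Bound = Σ ℕ λ N → N ≢ 0 × (∀ n → d n ℕ∣ N)

  admissible-constant : ∀ p {m} → ExactDegree p m → DegreeBelow p 1 → Admissible p → Bound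
  admissible-constant p {zero}  (c≢0 , _) p<1 adm-p =
    ∣ coeffℤ p 0 ∣ , (λ ∣c∣≡0 → c≢0 (ℤ.∣i∣≡0⇒i≡0 ∣c∣≡0)) ,
    λ n → ∣⇒∣ᵤ (subst (+ d n ∣_) (eval-constant n) (adm-p n))
    where
    coeffs : ∀ k → coeffℤ p k ≡ coeffℤ (coeffℤ p 0 ∷ []) k
    coeffs zero    = refl
    coeffs (suc k) = p<1 (suc k) (s≤s z≤n)
    eval-constant : ∀ n → eval p n ≡ coeffℤ p 0
    eval-constant n = trans (eval-coeffwise p (coeffℤ p 0 ∷ []) n coeffs)
                            (trans (cong (λ v → coeffℤ p 0 + v) (ℤ.*-zeroʳ n)) (ℤ.+-identityʳ _))
  admissible-constant p {suc m} (c≢0 , _) p<1 adm-p = ⊥-elim (c≢0 (p<1 (suc m) (s≤s z≤n)))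

  -- Euclid's algorithm run on admissible polynomials, by strong induction on
  -- the degree m of the current divisor p: pseudo-divide every fᵢ by p; a
  -- nonzero remainder is admissible of smaller degree, and if all remainders
  -- vanish then p divides every fᵢ in ℚ[x], so is constant by coprimality.
  descent : Coprime f → ∀ m p → ExactDegree p m → Admissible p → Bound
  descent coprime = <-rec (λ m → ∀ p → ExactDegree p m → Admissible p → Bound) step
    where
    step : ∀ m → (∀ {m'} → m' < m → ∀ p → ExactDegree p m' → Admissible p → Bound) →
           ∀ p → ExactDegree p m → Admissible p → Bound
    step m recurse p deg-p adm-p =
      conclude (all-or-some (λ i → zero-or-degree m (remainder (D i)) (remainder-degree (D i))))
      where
      open PseudoDivision
      D : ∀ i → PseudoDivision p m (f i)
      D i = pseudoDivide deg-p (f i)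

      conclude : (∀ i → IsZeroPoly (remainder (D i))) ⊎
                 (∃ λ i → ∃ λ m' → m' < m × ExactDegree (remainder (D i)) m') → Bound
      conclude (inj₂ (i , m' , m'<m , deg-r)) =
        recurse m'<m (remainder (D i)) deg-r (admissible-remainder (D i) (admissible-f i) adm-p)
      conclude (inj₁ all-zero) =
        admissible-constant p deg-p (constant-in-ℤ[x] p (coprime (toℚ[x] p) p∣f)) adm-p
        where
        p∣f : ∀ i → toℚ[x] p ∣ₚ toℚ[x] (f i)
        p∣f i = divides-in-ℚ[x] p (f i) (multiplier (D i)) (quotient (D i)) (multiplier≢0 (D i)) λ k →
          trans (identity (D i) k)
                (trans (cong (λ v → coeffℤ (p ⊛ quotient (D i)) k + v) (all-zero i k)) (ℤ.+-identityʳ _))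

  bound : Coprime f → (∀ i → ¬ IsZeroPoly (f i)) → Fin s → Bound
  bound coprime nonzero i₀ with zero-or-degree (length (f i₀)) (f i₀) (degreeBelow-length (f i₀))
  ... | inj₁ f≡0             = ⊥-elim (nonzero i₀ f≡0)
  ... | inj₂ (m , _ , deg-f) = descent coprime m (f i₀) deg-f (admissible-f i₀)

  -- gcd(d(x), M) depends only on x mod M, because fᵢ(x) ≡ fᵢ(y) (mod M).
  gcd-modulus-congruence : ∀ M x y → + M ∣ x - y → gcd (d x) M ≡ gcd (d y) M
  gcd-modulus-congruence M x y M∣x-y = ∣-antisym (divides-gcd x y M∣x-y) (divides-gcd y x M∣y-x)
    where
    M∣y-x : + M ∣ y - x
    M∣y-x = subst (+ M ∣_) (negate-difference x y) (∣m⇒∣-m M∣x-y)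
      where
      negate-difference : ∀ x y → - (x - y) ≡ y - x
      negate-difference = solve-∀
    divides-gcd : ∀ x y → + M ∣ x - y → gcd (d x) M ℕ∣ gcd (d y) M
    divides-gcd x y M∣x-y = gcd-greatest (gcdFam-greatest _ divides-fᵢ) (gcd[m,n]∣n (d x) M)
      where
      G : ℕ
      G = gcd (d x) M
      divides-fᵢ : ∀ i → G ℕ∣ ∣ eval (f i) y ∣
      divides-fᵢ i = ∣⇒∣ᵤ (subst (+ G ∣_) (cancel (eval (f i) x) (eval (f i) y)) (∣m∣n⇒∣m-n G∣fᵢx G∣difference))
        where
        G∣fᵢx : + G ∣ eval (f i) x
        G∣fᵢx = ∣-trans (∣ᵤ⇒∣ (gcd[m,n]∣m (d x) M)) (admissible-f i x)
        G∣difference : + G ∣ eval (f i) x - eval (f i) y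
        G∣difference = ∣-trans (∣ᵤ⇒∣ (gcd[m,n]∣n (d x) M)) (eval-congruence (+ M) x y M∣x-y (f i))
        cancel : ∀ u v → u - (u - v) ≡ v
        cancel = solve-∀

module CoprimeParts where

  open import Data.Nat using (ℕ; zero; suc; _*_; _<_; ≢-nonZero; s≤s; z≤n)
  import Data.Nat.Properties as ℕ
  open import Data.Nat.Divisibility using (_∣_; divides; ∣-trans; ∣-antisym; ∣-refl; n∣m*n; *-pres-∣)
  open import Data.Nat.GCD
    using (gcd; gcd[m,n]∣m; gcd[m,n]∣n; gcd-greatest; c*gcd[m,n]≡gcd[cm,cn]; gcd[m,n]≡0⇒m≡0)
  open import Data.Nat.Coprimality using (coprime-divisor; gcd≡1⇒coprime; 1-coprimeTo)
    renaming (Coprime to Coprimeℕ; sym to coprime-sym)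
  open import Data.Nat.LCM using (lcm; gcd*lcm)
  open import Data.Nat.Induction using (<-rec)
  open import Data.Nat.Tactic.RingSolver using (solve-∀)
  open import Data.Product using (_,_)
  open import Relation.Nullary using (yes; no)
  open import Data.Empty using (⊥-elim)
  open import Relation.Binary.PropositionalEquality

  coprime-∣ˡ : ∀ {m n k} → Coprimeℕ m n → k ∣ m → Coprimeℕ k n
  coprime-∣ˡ m⊥n k∣m (i∣k , i∣n) = m⊥n (∣-trans i∣k k∣m , i∣n)

  coprime-∣ʳ : ∀ {m n k} → Coprimeℕ m n → k ∣ n → Coprimeℕ m k
  coprime-∣ʳ m⊥n k∣n (i∣m , i∣k) = m⊥n (i∣m , ∣-trans i∣k k∣n)

  coprime-* : ∀ {k m n} → Coprimeℕ k m → Coprimeℕ k n → Coprimeℕ k (m * n)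
  coprime-* k⊥m k⊥n (i∣k , i∣mn) = k⊥n (i∣k , coprime-divisor (coprime-∣ˡ k⊥m i∣k) i∣mn)

  gcd-of-divisor : ∀ {m n} → m ∣ n → gcd m n ≡ m
  gcd-of-divisor {m} {n} m∣n = ∣-antisym (gcd[m,n]∣m m n) (gcd-greatest ∣-refl m∣n)

  gcd-coprime-factor : ∀ {U c} m → Coprimeℕ U c → gcd (c * m) U ≡ gcd m U
  gcd-coprime-factor {U} {c} m U⊥c = ∣-antisym
    (gcd-greatest (coprime-divisor (coprime-∣ˡ U⊥c (gcd[m,n]∣n (c * m) U)) (gcd[m,n]∣m (c * m) U))
                  (gcd[m,n]∣n (c * m) U))
    (gcd-greatest (∣-trans (gcd[m,n]∣m m U) (n∣m*n c)) (gcd[m,n]∣n m U))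

  coprime-product-divisor : ∀ {U V t} → Coprimeℕ U V → t ∣ U * V → t ≡ gcd t U * gcd t V
  coprime-product-divisor {U} {V} {t} U⊥V t∣UV = ∣-antisym t∣parts parts∣t
    where
    tU tV : ℕ
    tU = gcd t U
    tV = gcd t V
    t∣parts : t ∣ tU * tV
    t∣parts = subst (t ∣_) (sym (c*gcd[m,n]≡gcd[cm,cn] tU t V))
      (gcd-greatest (n∣m*n tU)
        (subst (t ∣_) (trans (sym (c*gcd[m,n]≡gcd[cm,cn] V t U)) (ℕ.*-comm V tU))
          (gcd-greatest (n∣m*n V) (subst (t ∣_) (ℕ.*-comm U V) t∣UV))))
    parts∣t : tU * tV ∣ t
    parts∣t with gcd[m,n]∣m t U
    ... | divides q t≡q*tU = subst (tU * tV ∣_) (trans (ℕ.*-comm tU q) (sym t≡q*tU)) (*-pres-∣ (∣-refl {tU}) tV∣q)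
      where
      -- tV divides t = tU·q and is coprime to tU, so it divides q.
      tV⊥tU : Coprimeℕ tV tU
      tV⊥tU = coprime-∣ʳ (coprime-∣ˡ (coprime-sym U⊥V) (gcd[m,n]∣n t V)) (gcd[m,n]∣n t U)
      tV∣q : tV ∣ q
      tV∣q = coprime-divisor tV⊥tU (subst (tV ∣_) (trans t≡q*tU (ℕ.*-comm q tU)) (gcd[m,n]∣m t V))

  lcm-cofactor : ∀ m n c → gcd m n ≢ 0 → c * gcd m n ≡ m → lcm m n ≡ c * n
  lcm-cofactor m n c g≢0 c*g≡m = ℕ.*-cancelˡ-≡ (lcm m n) (c * n) (gcd m n) {{≢-nonZero g≢0}} (begin
      gcd m n * lcm m n   ≡⟨ gcd*lcm m n ⟩
      m * n               ≡⟨ cong (_* n) (sym c*g≡m) ⟩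
      c * gcd m n * n     ≡⟨ cong (_* n) (ℕ.*-comm c (gcd m n)) ⟩
      gcd m n * c * n     ≡⟨ ℕ.*-assoc (gcd m n) c n ⟩
      gcd m n * (c * n)   ∎)
    where open ≡-Reasoning

  -- N = U·V where U is coprime to x and V absorbs the primes of x:
  -- everything coprime to x is coprime to V.
  record CoprimeSplit (N x : ℕ) : Set where
    field
      U V       : ℕ
      U*V≡N     : U * V ≡ N
      U⊥x       : Coprimeℕ U x
      absorbs-x : ∀ y → Coprimeℕ y x → Coprimeℕ y V

    U⊥V : Coprimeℕ U V
    U⊥V = absorbs-x U U⊥x

  1<n : ∀ {n} → n ≢ 0 → n ≢ 1 → 1 < n
  1<n {zero}        n≢0 _   = ⊥-elim (n≢0 refl)
  1<n {suc zero}    _   n≢1 = ⊥-elim (n≢1 refl)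
  1<n {suc (suc _)} _   _   = s≤s (s≤s z≤n)

  -- Divide out gcd(N, x) repeatedly; N strictly decreases while it exceeds 1.
  coprimeSplit : ∀ N → N ≢ 0 → ∀ x → CoprimeSplit N x
  coprimeSplit N N≢0 x = <-rec (λ N → N ≢ 0 → CoprimeSplit N x) step N N≢0
    where
    step : ∀ N → (∀ {N₁} → N₁ < N → N₁ ≢ 0 → CoprimeSplit N₁ x) → N ≢ 0 → CoprimeSplit N x
    step N recurse N≢0 with gcd N x ℕ.≟ 1 | gcd[m,n]∣m N x
    ... | yes h≡1 | _ = record
      { U = N ; V = 1 ; U*V≡N = ℕ.*-identityʳ N ; U⊥x = gcd≡1⇒coprime h≡1
      ; absorbs-x = λ y _ → coprime-sym (1-coprimeTo y) }
    ... | no  h≢1 | divides N₁ N≡N₁*h = record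
      { U = U ; V = h * V ; U*V≡N = U*hV≡N ; U⊥x = U⊥x
      ; absorbs-x = λ y y⊥x → coprime-* (coprime-∣ʳ y⊥x (gcd[m,n]∣n N x)) (absorbs-x y y⊥x) }
      where
      h : ℕ
      h = gcd N x
      N₁≢0 : N₁ ≢ 0
      N₁≢0 N₁≡0 = N≢0 (trans N≡N₁*h (cong (_* h) N₁≡0))
      1<h : 1 < h
      1<h = 1<n (λ h≡0 → N≢0 (gcd[m,n]≡0⇒m≡0 h≡0)) h≢1
      open CoprimeSplit (recurse (subst (N₁ <_) (sym N≡N₁*h) (ℕ.m<m*n N₁ h {{≢-nonZero N₁≢0}} 1<h)) N₁≢0)
      U*hV≡N : U * (h * V) ≡ N
      U*hV≡N = trans (rearrange U h V) (trans (cong (_* h) U*V≡N) (sym N≡N₁*h))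
        where
        rearrange : ∀ u h v → u * (h * v) ≡ u * v * h
        rearrange = solve-∀

module ChineseRemainder where

  open import Data.Nat as ℕ using (ℕ)
  open import Data.Nat.GCD using (module Bézout)
  open import Data.Nat.Coprimality using (coprime-Bézout) renaming (Coprime to Coprimeℕ)
  open import Data.Integer using (ℤ; +_; -_; _+_; _*_; _-_)
  import Data.Integer.Properties as ℤ
  open import Data.Integer.Divisibility.Signed using (_∣_; divides)
  open import Data.Integer.Tactic.RingSolver using (solve-∀)
  open import Data.Product using (∃; ∃₂; _×_; _,_)
  open import Relation.Binary.PropositionalEquality

  cast-identity : ∀ a b c e → 1 ℕ.+ a ℕ.* b ≡ c ℕ.* e → + 1 + + a * + b ≡ + c * + e
  cast-identity a b c e eq = begin
      + 1 + + a * + b     ≡⟨ cong (λ v → + 1 + v) (sym (ℤ.pos-* a b)) ⟩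
      + 1 + + (a ℕ.* b)   ≡⟨ sym (ℤ.pos-+ 1 (a ℕ.* b)) ⟩
      + (1 ℕ.+ a ℕ.* b)   ≡⟨ cong +_ eq ⟩
      + (c ℕ.* e)         ≡⟨ ℤ.pos-* c e ⟩
      + c * + e           ∎
    where open ≡-Reasoning

  bézout : ∀ {U V} → Coprimeℕ U V → ∃₂ λ α β → α * + U + β * + V ≡ + 1
  bézout {U} {V} U⊥V with coprime-Bézout U⊥V
  ... | Bézout.+- x y 1+yV≡xU =
    + x , - + y , trans (cong (λ v → v + - + y * + V) (sym (cast-identity y V x U 1+yV≡xU))) (cancel (+ y) (+ V))
    where
    cancel : ∀ y V → + 1 + y * V + - y * V ≡ + 1
    cancel = solve-∀
  ... | Bézout.-+ x y 1+xU≡yV =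
    - + x , + y , trans (cong (λ v → - + x * + U + v) (sym (cast-identity x U y V 1+xU≡yV))) (cancel (+ x) (+ U))
    where
    cancel : ∀ x U → - x * U + (+ 1 + x * U) ≡ + 1
    cancel = solve-∀

  chinese-remainder : ∀ {U V} → Coprimeℕ U V → ∀ n₁ n₂ → ∃ λ n → + U ∣ n - n₁ × + V ∣ n - n₂
  chinese-remainder {U} {V} U⊥V n₁ n₂ with bézout U⊥V
  ... | α , β , αU+βV≡1 = n , divides ((n₂ - n₁) * α) U-part , divides ((n₁ - n₂) * β) V-part
    where
    n : ℤ
    n = n₁ * (β * + V) + n₂ * (α * + U)
    times-one : ∀ z → z ≡ z * (α * + U + β * + V)
    times-one z = sym (trans (cong (z *_) αU+βV≡1) (ℤ.*-identityʳ z))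
    U-part : n - n₁ ≡ (n₂ - n₁) * α * + U
    U-part = trans (cong (λ v → n - v) (times-one n₁)) (identity n₁ n₂ α β (+ U) (+ V))
      where
      identity : ∀ n₁ n₂ α β U V → n₁ * (β * V) + n₂ * (α * U) - n₁ * (α * U + β * V) ≡ (n₂ - n₁) * α * U
      identity = solve-∀
    V-part : n - n₂ ≡ (n₁ - n₂) * β * + V
    V-part = trans (cong (λ v → n - v) (times-one n₂)) (identity n₁ n₂ α β (+ U) (+ V))
      where
      identity : ∀ n₁ n₂ α β U V → n₁ * (β * V) + n₂ * (α * U) - n₂ * (α * U + β * V) ≡ (n₁ - n₂) * β * V
      identity = solve-∀

module Extremal where

  open import Data.Nat using (ℕ; zero; suc; _<_; s≤s⁻¹)
  import Data.Nat.Properties as ℕ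
  open import Data.Integer using (ℤ; +_)
  open import Data.Product using (∃; _,_)
  open import Data.Sum using (inj₁; inj₂)
  open import Relation.Binary.Definitions using (Transitive)
  open import Relation.Binary.PropositionalEquality

  lower-bound-on-prefix : (d : ℤ → ℕ) (R : ℕ → ℕ → Set) → Transitive R →
    (_∙_ : ℕ → ℕ → ℕ) → (∀ x y → R (x ∙ y) x) → (∀ x y → R (x ∙ y) y) →
    (∀ n₁ n₂ → ∃ λ n → d n₁ ∙ d n₂ ≡ d n) →
    ∀ K → ∃ λ n → ∀ k → k < K → R (d n) (d (+ k))
  lower-bound-on-prefix d R trans-R _∙_ below-left below-right closed zero = + 0 , λ k ()
  lower-bound-on-prefix d R trans-R _∙_ below-left below-right closed (suc K)
    with lower-bound-on-prefix d R trans-R _∙_ below-left below-right closed K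
  ... | n₀ , n₀-below with closed n₀ (+ K)
  ...   | n , n₀∙K≡n = n , below
    where
    below : ∀ k → k < suc K → R (d n) (d (+ k))
    below k k<1+K with ℕ.m≤n⇒m<n∨m≡n (s≤s⁻¹ k<1+K)
    ... | inj₁ k<K  = trans-R (subst (λ v → R v (d n₀)) n₀∙K≡n (below-left _ _)) (n₀-below k k<K)
    ... | inj₂ refl = subst (λ v → R v (d (+ k))) n₀∙K≡n (below-right _ _)

module ResidueDetermined (d : ℤ → ℕ) (N : ℕ) (N≢0 : N ≢ 0)
  (d∣N : ∀ n → d n ℕ.∣ N)
  (gcd-congruence : ∀ M x y → + M ℤ.∣ x ℤ.- y → ℕ.gcd (d x) M ≡ ℕ.gcd (d y) M) where

  open CoprimeParts
  open ChineseRemainder using (chinese-remainder)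
  open Extremal using (lower-bound-on-prefix)
  open import Data.Nat using (suc; _*_; _<_; NonZero; ≢-nonZero; s≤s)
  open import Data.Nat.Divisibility using (_∣_; ∣-trans; ∣⇒≤)
  open import Data.Nat.DivMod using (_/_; m/n*n≡m)
  open import Data.Nat.GCD using (gcd; gcd[m,n]∣m; gcd[m,n]∣n; gcd[m,n]≡0⇒m≡0; gcd-comm)
  open import Data.Nat.LCM using (lcm; lcm-least; m∣lcm[m,n]; n∣lcm[m,n]; lcm-comm)
  open import Data.Nat.Coprimality using (coprime-/gcd) renaming (Coprime to Coprimeℕ; sym to coprime-sym)
  open import Data.Integer using (_+_; _-_)
  open import Data.Integer.DivMod using (_%ℕ_; _/ℕ_; n%ℕd<d; a≡a%ℕn+[a/ℕn]*n)
  open import Data.Integer.Divisibility.Signed using (divides) renaming (_∣_ to _∣ᶻ_)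
  open import Data.Integer.Tactic.RingSolver using (solve-∀)
  open import Data.List using (upTo)
  open import Data.List.Membership.Propositional using (_∈_)
  open import Data.List.Membership.Propositional.Properties using (∈-upTo⁺)
  open import Data.Product using (∃; _×_; _,_; proj₁; proj₂)
  open import Function using (flip)
  open import Relation.Binary.PropositionalEquality

  instance
    N≢0-instance : NonZero N
    N≢0-instance = ≢-nonZero N≢0

  -- Modulo N the family is determined by the residue: with M = N, gcd(d(x), N) = d(x).
  congruent-mod-N : ∀ x y → + N ∣ᶻ x - y → d x ≡ d y
  congruent-mod-N x y N∣x-y =
    trans (sym (gcd-of-divisor (d∣N x))) (trans (gcd-congruence N x y N∣x-y) (gcd-of-divisor (d∣N y)))

  periodic : ∀ n → d (n + + N) ≡ d n
  periodic n = congruent-mod-N (n + + N) n (divides (+ 1) (shift n (+ N)))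
    where
    shift : ∀ n N → n + N - n ≡ + 1 ℤ.* N
    shift = solve-∀

  reduce : ∀ n → d n ≡ d (+ (n %ℕ N))
  reduce n = congruent-mod-N n (+ (n %ℕ N)) (divides (n /ℕ N)
    (trans (cong (λ v → v - + (n %ℕ N)) (a≡a%ℕn+[a/ℕn]*n n N)) (cancel (+ (n %ℕ N)) (n /ℕ N) (+ N))))
    where
    cancel : ∀ r q N → r + q ℤ.* N - r ≡ q ℤ.* N
    cancel = solve-∀

  finitely-many-values : ∀ n → d n ∈ upTo (suc N)
  finitely-many-values n = ∈-upTo⁺ (s≤s (∣⇒≤ (d∣N n)))

  -- A divisor t of N = U·V (U, V coprime) whose U-part is that of some value
  -- d(n₁) and whose V-part is that of some value d(n₂) is itself a value:
  -- take n ≡ n₁ (mod U), n ≡ n₂ (mod V).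
  value-from-parts : ∀ {U V} → Coprimeℕ U V → U * V ≡ N → ∀ t → t ∣ N → ∀ n₁ n₂ →
                     gcd t U ≡ gcd (d n₁) U → gcd t V ≡ gcd (d n₂) V → ∃ λ n → t ≡ d n
  value-from-parts {U} {V} U⊥V U*V≡N t t∣N n₁ n₂ same-U same-V = n , t≡dn
    where
    solution : ∃ λ n → + U ∣ᶻ n - n₁ × + V ∣ᶻ n - n₂
    solution = chinese-remainder U⊥V n₁ n₂
    n : ℤ
    n = proj₁ solution
    U∣n-n₁ : + U ∣ᶻ n - n₁
    U∣n-n₁ = proj₁ (proj₂ solution)
    V∣n-n₂ : + V ∣ᶻ n - n₂
    V∣n-n₂ = proj₂ (proj₂ solution)
    U-parts : gcd t U ≡ gcd (d n) U
    U-parts = trans same-U (sym (gcd-congruence U n n₁ U∣n-n₁))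
    V-parts : gcd t V ≡ gcd (d n) V
    V-parts = trans same-V (sym (gcd-congruence V n n₂ V∣n-n₂))
    parts : ∀ {e} → e ∣ N → e ≡ gcd e U * gcd e V
    parts e∣N = coprime-product-divisor U⊥V (subst (_ ∣_) (sym U*V≡N) e∣N)
    t≡dn : t ≡ d n
    t≡dn = trans (parts t∣N) (trans (cong₂ _*_ U-parts V-parts) (sym (parts (d∣N n))))

  -- Write a = d(n₁) = a'·g, b = d(n₂) = b'·g with
  -- g = gcd(a, b) and a', b' coprime, and split N = U·V with U coprime to a'
  -- and V coprime to b'.  Then g and lcm(a, b) = a'·b = b'·a have the
  -- U- and V-parts of values, so they are values.
  module _ (n₁ n₂ : ℤ) where
    private
      a b g : ℕ
      a = d n₁
      b = d n₂
      g = gcd a b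
      g≢0 : g ≢ 0
      g≢0 g≡0 = N≢0 (ℕ.0∣⇒≡0 (subst (ℕ._∣ N) (gcd[m,n]≡0⇒m≡0 g≡0) (d∣N n₁)))
      instance
        g-nonzero : NonZero g
        g-nonzero = ≢-nonZero g≢0
      a' b' : ℕ
      a' = a / g
      b' = b / g
      a'g≡a : a' * g ≡ a
      a'g≡a = m/n*n≡m (gcd[m,n]∣m a b)
      b'g≡b : b' * g ≡ b
      b'g≡b = m/n*n≡m (gcd[m,n]∣n a b)
      open CoprimeSplit (coprimeSplit N N≢0 a')
      V⊥b' : Coprimeℕ V b'
      V⊥b' = coprime-sym (absorbs-x b' (coprime-sym (coprime-/gcd a b)))

    gcd-closed : ∃ λ n → gcd (d n₁) (d n₂) ≡ d n
    gcd-closed = value-from-parts U⊥V U*V≡N g (∣-trans (gcd[m,n]∣m a b) (d∣N n₁)) n₁ n₂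
      (sym (trans (cong (λ x → gcd x U) (sym a'g≡a)) (gcd-coprime-factor g U⊥x)))
      (sym (trans (cong (λ x → gcd x V) (sym b'g≡b)) (gcd-coprime-factor g V⊥b')))

    lcm-closed : ∃ λ n → lcm (d n₁) (d n₂) ≡ d n
    lcm-closed = value-from-parts U⊥V U*V≡N (lcm a b) (lcm-least (d∣N n₁) (d∣N n₂)) n₂ n₁
      (trans (cong (λ x → gcd x U) (lcm-cofactor a b a' g≢0 a'g≡a)) (gcd-coprime-factor b U⊥x))
      (trans (cong (λ x → gcd x V) lcm≡b'a) (gcd-coprime-factor a V⊥b'))
      where
      lcm≡b'a : lcm a b ≡ b' * a
      lcm≡b'a = trans (lcm-comm a b)
        (lcm-cofactor b a b' (subst (_≢ 0) (gcd-comm a b) g≢0) (trans (cong (b' *_) (gcd-comm b a)) b'g≡b))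

  least : ∃ λ n → ∀ m → d n ∣ d m
  least = n , λ m → subst (d n ∣_) (sym (reduce m)) (below (m %ℕ N) (n%ℕd<d m N))
    where
    prefix : ∃ λ n → ∀ k → k < N → d n ∣ d (+ k)
    prefix = lower-bound-on-prefix d _∣_ ∣-trans gcd gcd[m,n]∣m gcd[m,n]∣n gcd-closed N
    n : ℤ
    n = proj₁ prefix
    below : ∀ k → k < N → d n ∣ d (+ k)
    below = proj₂ prefix

  greatest : ∃ λ n → ∀ m → d m ∣ d n
  greatest = n , λ m → subst (_∣ d n) (sym (reduce m)) (above (m %ℕ N) (n%ℕd<d m N))
    where
    prefix : ∃ λ n → ∀ k → k < N → d (+ k) ∣ d n
    prefix = lower-bound-on-prefix d (flip _∣_) (flip ∣-trans) lcm m∣lcm[m,n] n∣lcm[m,n] lcm-closed N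
    n : ℤ
    n = proj₁ prefix
    above : ∀ k → k < N → d (+ k) ∣ d n
    above = proj₂ prefix

open import Data.Nat using (ℕ; suc; _≥_; _>_)
open import Data.Nat.Properties using (n≢0⇒n>0)
open import Data.Nat.Divisibility using (_∣_)
open import Data.Nat.GCD using (gcd)
open import Data.Nat.LCM using (lcm)
open import Data.Integer using (ℤ; +_; _+_)
open import Data.Fin using (Fin; fromℕ<)
open import Data.List using (List; upTo)
open import Data.List.Membership.Propositional using (_∈_)
open import Data.Product using (Σ; ∃; _×_; _,_)
open import Relation.Nullary using (¬_)
open import Relation.Binary.PropositionalEquality using (_≡_)

-- Step 1 produces N; the hypothesis s ≥ 2 is only used to name an index to
-- start Euclid's algorithm from.  Step 2 then gives all six claims.
theorem1p2 : (s : ℕ) → s ≥ 2 → (f : Fin s → Polyℤ) →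
    (∀ i → ¬ IsZeroPoly (f i)) → Coprime f →
    (Σ ℕ λ T → T > 0 × (∀ n → dₙ f (n + + T) ≡ dₙ f n))
    × (Σ (List ℕ) λ L → ∀ n → dₙ f n ∈ L)
    × (∀ n₁ n₂ → ∃ λ n → gcd (dₙ f n₁) (dₙ f n₂) ≡ dₙ f n)
    × (∀ n₁ n₂ → ∃ λ n → lcm (dₙ f n₁) (dₙ f n₂) ≡ dₙ f n)
    × (∃ λ n → ∀ m → dₙ f n ∣ dₙ f m)
    × (∃ λ n → ∀ m → dₙ f m ∣ dₙ f n)
theorem1p2 s s≥2 f nonzero coprime =
  let N , N≢0 , d∣N = bound coprime nonzero (fromℕ< s≥2)
      open ResidueDetermined (dₙ f) N N≢0 d∣N gcd-modulus-congruence
  in  (N , n≢0⇒n>0 N≢0 , periodic)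
    , (upTo (suc N) , finitely-many-values)
    , gcd-closed
    , lcm-closed
    , least
    , greatest
  where open GcdOfValues f using (bound; gcd-modulus-congruence)
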